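{- Let $\ell\ge 3$ be prime and let $r,s,t$ be positive integers with $\gcd(r,s,t)=1$. Let $q=2k\ell+1$ be a prime (with $k$ a positive integer) not dividing $r$. Define \[ \mu(\ell,q)=\{\eta^{2\ell}:\eta\in\mathbb{F}_q\}=\{0\}\cup\{\zeta\in\mathbb{F}_q^*:\zeta^k=1\} \] and \[ B(\ell,q)=\{\zeta\in\mu(\ell,q): ((s\zeta+t)/r)^{2k}\in\{0,1\}\}, \] where the computation is in $\mathbb{F}_q$. If $B(\ell,q)=\emptyset$, then the equation $r y_2^\ell-s y_1^{2\ell}=t$ has no solutions in integers $y_1,y_2$. -}

module Defs where

open import Data.Nat using (ℕ; _+_; _*_; _∸_; _^_; _<_; _%_)
open import Data.Product using (∃-syntax; _×_)
open import Data.Sum using (_⊎_)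
open import Relation.Binary.PropositionalEquality using (_≡_)

-- Model of 𝔽_q (q prime): residues 0 … q-1, arithmetic in ℕ reduced mod q.
-- Division by r (with q ∤ r) is multiplication by the inverse r^(q-2) mod q
-- (Fermat's little theorem).
module FieldOps (q : ℕ) .{{_ : Data.Nat.NonZero q}} where

  inv : ℕ → ℕ
  inv r = (r ^ (q ∸ 2)) % q

  InMu : (ℓ ζ : ℕ) → Set
  InMu ℓ ζ = ∃[ η ] (η < q × (η ^ (2 * ℓ)) % q ≡ ζ)

  InB : (ℓ k r s t ζ : ℕ) → Set
  InB ℓ k r s t ζ =
    InMu ℓ ζ ×
    (let x = ((s * ζ + t) * inv r) % q in
     ((x ^ (2 * k)) % q ≡ 0 ⊎ (x ^ (2 * k)) % q ≡ 1))

{-# OPTIONS --safe #-}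
module Submission where

-- Reducing a solution modulo q, with a = y₂ mod q and b = y₁ mod q, gives r a^ℓ ≡ s b^(2ℓ) + t
-- in 𝔽_q.  Then ζ = b^(2ℓ) lies in μ(ℓ,q), and (sζ + t)/r = a^ℓ, whose 2k-th power a^(2kℓ) = a^(q-1)
-- is 0 or 1 by Fermat's little theorem; so ζ ∈ B(ℓ,q).  Fermat's theorem itself follows by induction
-- from the freshman's dream (x + y)^p ≡ x^p + y^p, as p divides every inner binomial coefficient.

open import Defs
open import Data.Nat as ℕ using (ℕ; zero; suc; 2+; _+_; _*_; _∸_; _^_; _≤_; _<_; s≤s; z≤n; NonZero)
open import Data.Nat.Primality using (Prime; euclidsLemma; ¬prime[0]; ¬prime[1])
open import Data.Nat.Divisibility using (_∣_; divides; _∣?_; ∣-trans; m∣m*n; ∣⇒≤; _∣0; ∣m∣n⇒∣m+n; n∣m⇒m%n≡0)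
open import Data.Nat.GCD using (gcd)
open import Data.Integer as ℤ using (ℤ; +_)
open import Data.Product using (∃-syntax; _,_; proj₂)
open import Relation.Nullary using (¬_)
open import Relation.Binary.PropositionalEquality using (_≡_)

open import Data.Nat.Properties
open import Data.Nat.DivMod hiding (_mod_)
open import Data.Nat.Combinatorics using (_C_; nCn≡1; nC1≡n; nCk+nC[k+1]≡[n+1]C[k+1])
open import Data.Fin using (Fin; zero; suc; toℕ; inject₁; fromℕ)
open import Data.Fin.Properties using (inject₁ℕ<; toℕ-fromℕ)
open import Data.Vec.Functional using (Vector)
open import Data.Sum using (_⊎_; inj₁; inj₂; map)
open import Data.Empty using (⊥-elim)
open import Function using (_∘_)
open import Relation.Nullary using (yes; no)
open import Relation.Binary.PropositionalEquality using (refl; sym; trans; cong; cong₂; subst; subst₂; module ≡-Reasoning)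
open import Algebra.Properties.Semiring.Sum +-*-semiring using (sum; sum-init-last; sum-cong-≗)
import Algebra.Properties.CommutativeSemiring.Binomial +-*-commutativeSemiring as Binomial
import Algebra.Definitions.RawSemiring ℕ.+-*-rawSemiring as Semiring
open import Data.Integer.Properties using (pos-+; pos-*; +-injective)
open import Data.Integer.DivMod using (_%ℕ_; _/ℕ_; n%ℕd<d; a≡a%ℕn+[a/ℕn]*n)
open import Data.Integer.Tactic.RingSolver using (solve-∀)
import Data.Nat.Tactic.RingSolver as ℕ-Solver

infix 4 _≡_mod_

_≡_mod_ : ℕ → ℕ → (n : ℕ) → .{{NonZero n}} → Set
a ≡ b mod n = a % n ≡ b % n

module _ (n : ℕ) .{{_ : NonZero n}} where

  %-mod : ∀ a → a % n ≡ a mod n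
  %-mod a = m%n%n≡m%n a n

  +-cong-mod : ∀ {a a′ b b′} → a ≡ a′ mod n → b ≡ b′ mod n → a + b ≡ a′ + b′ mod n
  +-cong-mod {a} {a′} {b} {b′} a≡a′ b≡b′ = begin
    (a + b) % n               ≡⟨ %-distribˡ-+ a b n ⟩
    (a % n + b % n) % n       ≡⟨ cong₂ (λ u v → (u + v) % n) a≡a′ b≡b′ ⟩
    (a′ % n + b′ % n) % n     ≡⟨ %-distribˡ-+ a′ b′ n ⟨
    (a′ + b′) % n             ∎
    where open ≡-Reasoning

  *-cong-mod : ∀ {a a′ b b′} → a ≡ a′ mod n → b ≡ b′ mod n → a * b ≡ a′ * b′ mod n
  *-cong-mod {a} {a′} {b} {b′} a≡a′ b≡b′ = begin
    (a * b) % n               ≡⟨ %-distribˡ-* a b n ⟩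
    (a % n * (b % n)) % n     ≡⟨ cong₂ (λ u v → (u * v) % n) a≡a′ b≡b′ ⟩
    (a′ % n * (b′ % n)) % n   ≡⟨ %-distribˡ-* a′ b′ n ⟨
    (a′ * b′) % n             ∎
    where open ≡-Reasoning

  ^-cong-mod : ∀ {a b} k → a ≡ b mod n → a ^ k ≡ b ^ k mod n
  ^-cong-mod zero    a≡b = refl
  ^-cong-mod (suc k) a≡b = *-cong-mod a≡b (^-cong-mod k a≡b)

  *-congˡ-mod : ∀ a {b b′} → b ≡ b′ mod n → a * b ≡ a * b′ mod n
  *-congˡ-mod a = *-cong-mod {a} {a} refl

  *-congʳ-mod : ∀ {a a′} b → a ≡ a′ mod n → a * b ≡ a′ * b mod n
  *-congʳ-mod b a≡a′ = *-cong-mod {b = b} {b} a≡a′ refl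

  +-congˡ-mod : ∀ a {b b′} → b ≡ b′ mod n → a + b ≡ a + b′ mod n
  +-congˡ-mod a = +-cong-mod {a} {a} refl

  +-congʳ-mod : ∀ {a a′} b → a ≡ a′ mod n → a + b ≡ a′ + b mod n
  +-congʳ-mod b a≡a′ = +-cong-mod {b = b} {b} a≡a′ refl

  mod⇒∣∸ : ∀ a b → a ≡ b mod n → n ∣ a ∸ b
  mod⇒∣∸ a b a≡b = divides (a / n ∸ b / n) (begin
    a ∸ b                                 ≡⟨ cong₂ _∸_ (m≡m%n+[m/n]*n a n) (m≡m%n+[m/n]*n b n) ⟩
    (a % n + a / n * n) ∸ (b % n + b / n * n) ≡⟨ cong (λ u → (u + a / n * n) ∸ (b % n + b / n * n)) a≡b ⟩
    (b % n + a / n * n) ∸ (b % n + b / n * n) ≡⟨ [m+n]∸[m+o]≡n∸o (b % n) _ _ ⟩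
    a / n * n ∸ b / n * n                 ≡⟨ *-distribʳ-∸ n (a / n) (b / n) ⟨
    (a / n ∸ b / n) * n                   ∎)
    where open ≡-Reasoning

  ∣∸⇒mod : ∀ {a b} → b ≤ a → n ∣ a ∸ b → a ≡ b mod n
  ∣∸⇒mod {a} {b} b≤a (divides c a∸b≡c*n) = begin
    a % n               ≡⟨ cong (_% n) (m+[n∸m]≡n b≤a) ⟨
    (b + (a ∸ b)) % n   ≡⟨ cong (λ u → (b + u) % n) a∸b≡c*n ⟩
    (b + c * n) % n     ≡⟨ [m+kn]%n≡m%n b c n ⟩
    b % n               ∎
    where open ≡-Reasoning

  *-cancelˡ-mod-≤ : Prime n → ∀ {a u v} → ¬ n ∣ a → v ≤ u → a * u ≡ a * v mod n → u ≡ v mod n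
  *-cancelˡ-mod-≤ n-prime {a} {u} {v} n∤a v≤u au≡av
    with euclidsLemma a (u ∸ v) n-prime (subst (n ∣_) (sym (*-distribˡ-∸ a u v)) (mod⇒∣∸ (a * u) (a * v) au≡av))
  ... | inj₁ n∣a   = ⊥-elim (n∤a n∣a)
  ... | inj₂ n∣u∸v = ∣∸⇒mod v≤u n∣u∸v

  *-cancelˡ-mod : Prime n → ∀ {a u v} → ¬ n ∣ a → a * u ≡ a * v mod n → u ≡ v mod n
  *-cancelˡ-mod n-prime {u = u} {v} n∤a au≡av with ≤-total v u
  ... | inj₁ v≤u = *-cancelˡ-mod-≤ n-prime n∤a v≤u au≡av
  ... | inj₂ u≤v = sym (*-cancelˡ-mod-≤ n-prime n∤a u≤v (sym au≡av))

[1+k]*[1+n]C[1+k]≡[1+n]*nCk : ∀ n k → suc k * (suc n C suc k) ≡ suc n * (n C k)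
[1+k]*[1+n]C[1+k]≡[1+n]*nCk zero    zero    = refl
[1+k]*[1+n]C[1+k]≡[1+n]*nCk zero    (suc k) = *-zeroʳ (2 + k)
[1+k]*[1+n]C[1+k]≡[1+n]*nCk (suc n) zero    = trans (+-identityʳ _) (trans (nC1≡n (2 + n)) (sym (*-identityʳ _)))
[1+k]*[1+n]C[1+k]≡[1+n]*nCk (suc n) (suc k) = begin
  suc K * (suc N C suc K)                      ≡⟨ cong (suc K *_) (nCk+nC[k+1]≡[n+1]C[k+1] N K) ⟨
  suc K * (N C K + N C suc K)                  ≡⟨ *-distribˡ-+ (suc K) (N C K) (N C suc K) ⟩
  suc K * (N C K) + suc K * (N C suc K)        ≡⟨ cong (_+_ (suc K * (N C K))) ([1+k]*[1+n]C[1+k]≡[1+n]*nCk n K) ⟩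
  N C K + K * (N C K) + N * (n C K)            ≡⟨ cong (λ u → N C K + u + N * (n C K)) ([1+k]*[1+n]C[1+k]≡[1+n]*nCk n k) ⟩
  N C K + N * (n C k) + N * (n C K)            ≡⟨ +-assoc (N C K) _ _ ⟩
  N C K + (N * (n C k) + N * (n C K))          ≡⟨ cong (_+_ (N C K)) (*-distribˡ-+ N (n C k) (n C K)) ⟨
  N C K + N * (n C k + n C K)                  ≡⟨ cong (λ u → N C K + N * u) (nCk+nC[k+1]≡[n+1]C[k+1] n k) ⟩
  N C K + N * (N C K)                          ∎
  where
  open ≡-Reasoning
  N = suc n
  K = suc k

p∣pCk : ∀ {p k} → Prime p → 0 < k → k < p → p ∣ p C k
p∣pCk {suc n} {suc k} p-prime _ (s≤s k<n)
  with euclidsLemma (suc k) (suc n C suc k) p-prime (divides (n C k) (trans ([1+k]*[1+n]C[1+k]≡[1+n]*nCk n k) (*-comm (suc n) _)))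
... | inj₁ p∣1+k  = ⊥-elim (<⇒≱ (s≤s k<n) (∣⇒≤ p∣1+k))
... | inj₂ p∣pCk = p∣pCk

^≡Semiring^ : ∀ x n → x Semiring.^ n ≡ x ^ n
^≡Semiring^ x zero    = refl
^≡Semiring^ x (suc n) = cong (x *_) (^≡Semiring^ x n)

×≡* : ∀ k x → k Semiring.× x ≡ k * x
×≡* zero    x = refl
×≡* (suc k) x = cong (_+_ x) (×≡* k x)

binomialTerm : ℕ → ℕ → ℕ → ℕ → ℕ
binomialTerm n x y k = (n C k) * (x ^ k * y ^ (n ∸ k))

binomial-theorem : ∀ n x y → (x + y) ^ n ≡ sum {suc n} (binomialTerm n x y ∘ toℕ)
binomial-theorem n x y = begin
  (x + y) ^ n                        ≡⟨ ^≡Semiring^ (x + y) n ⟨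
  (x + y) Semiring.^ n               ≡⟨ Binomial.theorem n x y ⟩
  Binomial.binomialExpansion x y n   ≡⟨ sum-cong-≗ {suc n} term≡ ⟩
  sum {suc n} (binomialTerm n x y ∘ toℕ)   ∎
  where
  open ≡-Reasoning
  term≡ : ∀ i → Binomial.binomialTerm x y n i ≡ binomialTerm n x y (toℕ i)
  term≡ i = trans (×≡* (n C toℕ i) _)
                  (cong ((n C toℕ i) *_) (cong₂ _*_ (^≡Semiring^ x (toℕ i)) (^≡Semiring^ y (n ∸ toℕ i))))

∣-sum : ∀ {d n} (f : Vector ℕ n) → (∀ i → d ∣ f i) → d ∣ sum f
∣-sum {n = zero}  f d∣f = _ ∣0
∣-sum {n = suc n} f d∣f = ∣m∣n⇒∣m+n (d∣f zero) (∣-sum (f ∘ suc) (d∣f ∘ suc))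

module _ {m : ℕ} (p-prime : Prime (suc m)) where

  freshman's-dream : ∀ x y → (x + y) ^ suc m ≡ x ^ suc m + y ^ suc m mod suc m
  freshman's-dream x y = begin
    (x + y) ^ p % p                    ≡⟨ cong (_% p) (binomial-theorem p x y) ⟩
    (T zero + sum (T ∘ suc)) % p       ≡⟨ cong (λ u → (T zero + u) % p) (sum-init-last (T ∘ suc)) ⟩
    (T zero + (sum M + T (fromℕ p))) % p ≡⟨ cong₂ (λ u v → (u + (sum M + v)) % p) T-first T-last ⟩
    (y ^ p + (sum M + x ^ p)) % p      ≡⟨ cong (_% p) (rearrange (y ^ p) (sum M) (x ^ p)) ⟩
    (x ^ p + y ^ p + sum M) % p        ≡⟨ %-remove-+ʳ (x ^ p + y ^ p) (∣-sum M p∣M) ⟩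
    (x ^ p + y ^ p) % p                ∎
    where
    open ≡-Reasoning
    p = suc m
    T : Fin (suc p) → ℕ
    T = binomialTerm p x y ∘ toℕ
    M : Fin m → ℕ
    M j = T (suc (inject₁ j))
    T-first : T zero ≡ y ^ p
    T-first = trans (*-identityˡ _) (*-identityˡ _)
    T-last : T (fromℕ p) ≡ x ^ p
    T-last = begin
      binomialTerm p x y (toℕ (fromℕ p)) ≡⟨ cong (binomialTerm p x y) (toℕ-fromℕ p) ⟩
      (p C p) * (x ^ p * y ^ (p ∸ p))    ≡⟨ cong₂ (λ u v → u * (x ^ p * y ^ v)) (nCn≡1 p) (n∸n≡0 p) ⟩
      1 * (x ^ p * 1)                    ≡⟨ trans (*-identityˡ _) (*-identityʳ _) ⟩
      x ^ p                              ∎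
    p∣M : ∀ j → p ∣ M j
    p∣M j = ∣-trans (p∣pCk p-prime (s≤s z≤n) (s≤s (inject₁ℕ< j))) (m∣m*n _)
    rearrange : ∀ a b c → a + (b + c) ≡ c + a + b
    rearrange = ℕ-Solver.solve-∀

  fermat : ∀ a → a ^ suc m ≡ a mod suc m
  fermat zero    = refl
  fermat (suc a) = begin
    (1 + a) ^ p % p        ≡⟨ freshman's-dream 1 a ⟩
    (1 ^ p + a ^ p) % p    ≡⟨ cong (λ u → (u + a ^ p) % p) (^-zeroˡ p) ⟩
    (1 + a ^ p) % p        ≡⟨ +-congˡ-mod p 1 (fermat a) ⟩
    (1 + a) % p            ∎
    where
    open ≡-Reasoning
    p = suc m

  fermat-little : ∀ {a} → ¬ suc m ∣ a → a ^ m ≡ 1 mod suc m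
  fermat-little {a} p∤a =
    *-cancelˡ-mod (suc m) p-prime p∤a (trans (fermat a) (cong (_% suc m) (sym (*-identityʳ a))))

infix 4 _≡_modℤ_

_≡_modℤ_ : ℤ → ℤ → ℕ → Set
x ≡ y modℤ n = ∃[ c ] (x ≡ y ℤ.+ c ℤ.* + n)

^-cong-modℤ : ∀ {n x y} k → x ≡ y modℤ n → x ℤ.^ k ≡ y ℤ.^ k modℤ n
^-cong-modℤ zero    _ = + 0 , refl
^-cong-modℤ {n} {y = y} (suc k) (c , refl) with ^-cong-modℤ k (c , refl)
... | c′ , x^k≡y^k+c′n = y ℤ.* c′ ℤ.+ c ℤ.* y ℤ.^ k ℤ.+ c ℤ.* c′ ℤ.* + n ,
    trans (cong ((y ℤ.+ c ℤ.* + n) ℤ.*_) x^k≡y^k+c′n) (expand y (y ℤ.^ k) c c′ (+ n))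
  where
  expand : ∀ y yᵏ c c′ n → (y ℤ.+ c ℤ.* n) ℤ.* (yᵏ ℤ.+ c′ ℤ.* n) ≡ y ℤ.* yᵏ ℤ.+ (y ℤ.* c′ ℤ.+ c ℤ.* yᵏ ℤ.+ c ℤ.* c′ ℤ.* n) ℤ.* n
  expand = solve-∀

linear-modℤ : ∀ {n} r s {t x y a b} → r ℤ.* x ℤ.- s ℤ.* y ≡ t → x ≡ a modℤ n → y ≡ b modℤ n →
              r ℤ.* a ≡ s ℤ.* b ℤ.+ t modℤ n
linear-modℤ {n} r s {a = a} {b} refl (c₂ , refl) (c₁ , refl) =
  s ℤ.* c₁ ℤ.- r ℤ.* c₂ , regroup r s a b c₁ c₂ (+ n)
  where
  regroup : ∀ r s a b c₁ c₂ n → r ℤ.* a ≡ s ℤ.* b ℤ.+ (r ℤ.* (a ℤ.+ c₂ ℤ.* n) ℤ.- s ℤ.* (b ℤ.+ c₁ ℤ.* n)) ℤ.+ (s ℤ.* c₁ ℤ.- r ℤ.* c₂) ℤ.* n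
  regroup = solve-∀

modℤ-sym : ∀ {n x y} → x ≡ y modℤ n → y ≡ x modℤ n
modℤ-sym {n} {y = y} (c , x≡y+cn) =
  ℤ.- c , trans (cancel y c (+ n)) (cong (ℤ._+ (ℤ.- c) ℤ.* + n) (sym x≡y+cn))
  where
  cancel : ∀ y c n → y ≡ y ℤ.+ c ℤ.* n ℤ.+ (ℤ.- c) ℤ.* n
  cancel = solve-∀

pos-^ : ∀ a k → + (a ^ k) ≡ (+ a) ℤ.^ k
pos-^ a zero    = refl
pos-^ a (suc k) = trans (pos-* a (a ^ k)) (cong (+ a ℤ.*_) (pos-^ a k))

pos-*-^ : ∀ r a k → + (r * a ^ k) ≡ + r ℤ.* (+ a) ℤ.^ k
pos-*-^ r a k = trans (pos-* r (a ^ k)) (cong (+ r ℤ.*_) (pos-^ a k))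

module _ (n : ℕ) .{{_ : NonZero n}} where

  %ℕ-modℤ : ∀ y → y ≡ + (y %ℕ n) modℤ n
  %ℕ-modℤ y = y /ℕ n , a≡a%ℕn+[a/ℕn]*n y n

  +-modℤ⇒mod : ∀ {a b} d → + a ≡ + b ℤ.+ + d ℤ.* + n → a ≡ b mod n
  +-modℤ⇒mod {a} {b} d a≡b+dn = begin
    a % n             ≡⟨ cong (_% n) (+-injective (trans a≡b+dn (cong (ℤ._+_ (+ b)) (sym (pos-* d n))))) ⟩
    (b + d * n) % n   ≡⟨ [m+kn]%n≡m%n b d n ⟩
    b % n             ∎
    where open ≡-Reasoning

  modℤ⇒mod : ∀ {a b} → + a ≡ + b modℤ n → a ≡ b mod n
  modℤ⇒mod (+ d      , a≡b+dn) = +-modℤ⇒mod d a≡b+dn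
  modℤ⇒mod (ℤ.-[1+ d ] , a≡b+dn) = sym (+-modℤ⇒mod (suc d) (proj₂ (modℤ-sym {n} (ℤ.-[1+ d ] , a≡b+dn))))

  solution⇒mod : ∀ {r s t ℓ y₁ y₂} → (+ r) ℤ.* (y₂ ℤ.^ ℓ) ℤ.- (+ s) ℤ.* (y₁ ℤ.^ (2 * ℓ)) ≡ + t →
                 r * (y₂ %ℕ n) ^ ℓ ≡ s * (y₁ %ℕ n) ^ (2 * ℓ) + t mod n
  solution⇒mod {r} {s} {t} {ℓ} {y₁} {y₂} sol = modℤ⇒mod (subst₂ (λ u v → u ≡ v modℤ n)
    (sym (pos-*-^ r (y₂ %ℕ n) ℓ))
    (sym (trans (pos-+ _ t) (cong (ℤ._+ + t) (pos-*-^ s (y₁ %ℕ n) (2 * ℓ)))))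
    (linear-modℤ (+ r) (+ s) sol
      (^-cong-modℤ {n} ℓ (%ℕ-modℤ y₂)) (^-cong-modℤ {n} (2 * ℓ) (%ℕ-modℤ y₁))))

module _ (q : ℕ) .{{_ : NonZero q}} where

  open FieldOps q

  solution⇒∈B : ∀ {ℓ k r s t} → r * inv r ≡ 1 mod q →
                (∀ a → a ^ (2 * k * ℓ) % q ≡ 0 ⊎ a ^ (2 * k * ℓ) % q ≡ 1) →
                ∀ a b → b < q → r * a ^ ℓ ≡ s * b ^ (2 * ℓ) + t mod q →
                InB ℓ k r s t (b ^ (2 * ℓ) % q)
  solution⇒∈B {ℓ} {k} {r} {s} {t} r*inv≡1 ^2kℓ≡0∨1 a b b<q sol =
    (b , b<q , refl) , map (trans x^2k≡a^2kℓ) (trans x^2k≡a^2kℓ) (^2kℓ≡0∨1 a)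
    where
    ζ = b ^ (2 * ℓ) % q
    x = ((s * ζ + t) * inv r) % q
    x≡a^ℓ : x ≡ a ^ ℓ mod q
    x≡a^ℓ = begin
      x % q                                ≡⟨ %-mod q ((s * ζ + t) * inv r) ⟩
      ((s * ζ + t) * inv r) % q            ≡⟨ *-congʳ-mod q (inv r) (+-congʳ-mod q t (*-congˡ-mod q s (%-mod q _))) ⟩
      ((s * b ^ (2 * ℓ) + t) * inv r) % q  ≡⟨ *-congʳ-mod q (inv r) sol ⟨
      (r * a ^ ℓ * inv r) % q              ≡⟨ cong (_% q) (*-comm-middle r (a ^ ℓ) (inv r)) ⟩
      (a ^ ℓ * (r * inv r)) % q            ≡⟨ *-congˡ-mod q (a ^ ℓ) r*inv≡1 ⟩
      (a ^ ℓ * 1) % q                      ≡⟨ cong (_% q) (*-identityʳ _) ⟩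
      a ^ ℓ % q                            ∎
      where
      open ≡-Reasoning
      *-comm-middle : ∀ u v w → u * v * w ≡ v * (u * w)
      *-comm-middle = ℕ-Solver.solve-∀
    x^2k≡a^2kℓ : x ^ (2 * k) ≡ a ^ (2 * k * ℓ) mod q
    x^2k≡a^2kℓ = trans (^-cong-mod q (2 * k) x≡a^ℓ)
                       (cong (_% q) (trans (^-*-assoc a ℓ (2 * k)) (cong (a ^_) (*-comm ℓ (2 * k)))))

module _ {m : ℕ} (q-prime : Prime (2+ m)) where

  ^[p-1]≡0∨1 : ∀ a → a ^ suc m % 2+ m ≡ 0 ⊎ a ^ suc m % 2+ m ≡ 1
  ^[p-1]≡0∨1 a with 2+ m ∣? a
  ... | yes q∣a = inj₁ (n∣m⇒m%n≡0 _ (2+ m) (∣-trans q∣a (m∣m*n _)))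
  ... | no  q∤a = inj₂ (fermat-little q-prime q∤a)

  *-inv≡1 : ∀ {r} → ¬ 2+ m ∣ r → r * FieldOps.inv (2+ m) r ≡ 1 mod 2+ m
  *-inv≡1 {r} q∤r =
    trans (*-congˡ-mod (2+ m) r {r ^ m % 2+ m} {r ^ m} (%-mod (2+ m) (r ^ m))) (fermat-little q-prime q∤r)

lemma6p1 : (ℓ r s t k q : ℕ) → Prime ℓ → 3 ≤ ℓ → 1 ≤ r → 1 ≤ s → 1 ≤ t → gcd (gcd r s) t ≡ 1 → 1 ≤ k → q ≡ 2 * k * ℓ + 1 → Prime q → ¬ (q ∣ r) → .{{_ : NonZero q}}
    → (∀ ζ → ¬ FieldOps.InB q ℓ k r s t ζ)
    → ¬ (∃[ y₁ ] ∃[ y₂ ] ((+ r) ℤ.* (y₂ ℤ.^ ℓ) ℤ.- (+ s) ℤ.* (y₁ ℤ.^ (2 * ℓ)) ≡ + t))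
lemma6p1 ℓ r s t k 0      _ _ _ _ _ _ _ _ q-prime _ _ _ = ¬prime[0] q-prime
lemma6p1 ℓ r s t k 1      _ _ _ _ _ _ _ _ q-prime _ _ _ = ¬prime[1] q-prime
lemma6p1 ℓ r s t k (2+ m) _ _ _ _ _ _ _ q≡2kℓ+1 q-prime q∤r B≡∅ (y₁ , y₂ , sol) =
  B≡∅ _ (solution⇒∈B q {ℓ} {k} {r} {s} {t} (*-inv≡1 q-prime q∤r) ^2kℓ≡0∨1 (y₂ %ℕ q) (y₁ %ℕ q) (n%ℕd<d y₁ q)
                      (solution⇒mod q {r} {s} {t} {ℓ} {y₁} {y₂} sol))
  where
  q = 2+ m
  2kℓ≡q-1 : 2 * k * ℓ ≡ suc m
  2kℓ≡q-1 = sym (suc-injective (trans q≡2kℓ+1 (+-comm (2 * k * ℓ) 1)))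
  ^2kℓ≡0∨1 : ∀ a → a ^ (2 * k * ℓ) % q ≡ 0 ⊎ a ^ (2 * k * ℓ) % q ≡ 1
  ^2kℓ≡0∨1 rewrite 2kℓ≡q-1 = ^[p-1]≡0∨1 q-prime
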